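{- For integers $r\ge1$, $n\ge0$, $N\ge1$ and $x\in\mathbb{C}$, define $D_r^{(N)}(n;x)\coloneqq\sum_{k=0}^{N-1}\frac{k^nx^k}{(k!)^r}$ (with $0^0=1$). Then \[ D_r^{(N)}(n+r;x)=x\sum_{k=0}^{n}\binom{n}{k}D_r^{(N)}(k;x)-\frac{N^nx^N}{((N-1)!)^r}. \] -}

module Defs where

open import Level using (Level)
open import Data.Nat using (ℕ; suc; _∸_)
open import Data.Nat.Combinatorics using (_C_)
open import Data.Nat using (_!)
open import Data.Fin using (Fin; toℕ)
open import Algebra.Bundles using (CommutativeRing; Semiring)
import Algebra.Definitions.RawSemiring as RS

-- We work in an arbitrary commutative ring R in which every factorial k!
-- is invertible (e.g. ℂ, or any field of characteristic 0), the inverse of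
-- k! being supplied as  invFact k.
module _ {c ℓ : Level} (R : CommutativeRing c ℓ) where
  open CommutativeRing R
  open RS (Semiring.rawSemiring semiring) using (_^_; _×_; sum)

  ι : ℕ → Carrier
  ι k = k × 1#

  IsInvFact : (ℕ → Carrier) → Set ℓ
  IsInvFact inv = ∀ k → ι (k !) * inv k ≈ 1#

  -- D_r^{(N)}(n;x) = Σ_{k=0}^{N-1} k^n x^k / (k!)^r   (0^0 = 1 since _^ 0 = 1#)
  D : (invFact : ℕ → Carrier) (r N n : ℕ) (x : Carrier) → Carrier
  D invFact r N n x = sum {N} (λ (k : Fin N) →
      (ι (toℕ k) ^ n) * (x ^ toℕ k) * (invFact (toℕ k) ^ r))

  RHS : (invFact : ℕ → Carrier) (r N n : ℕ) (x : Carrier) → Carrier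
  RHS invFact r N n x =
      x * sum {suc n} (λ (k : Fin (suc n)) → ι (n C toℕ k) * D invFact r N (toℕ k) x)
    - (ι N ^ n) * (x ^ N) * (invFact (N ∸ 1) ^ r)

-- Write t(m, k) = k^m x^k / (k!)^r, so that D^{(N)}(m) = Σ_{k<N} t(m, k).  Since
-- (k+1)^r / ((k+1)!)^r = 1 / (k!)^r, we get t(n + r, k + 1) = (k+1)^n x^{k+1} / (k!)^r,
-- and expanding (k+1)^n binomially this is x Σ_i C(n,i) t(i, k).  The k = 0 term of
-- D^{(N)}(n + r) vanishes because n + r ≥ 1, so shifting the index and exchanging the
-- sums gives D^{(N)}(n + r) = x Σ_i C(n,i) D^{(N-1)}(i).  Finally D^{(N)}(i) exceeds
-- D^{(N-1)}(i) by t(i, N - 1), and by the same binomial identity x Σ_i C(n,i) t(i, N - 1)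
-- is exactly the correction term N^n x^N / ((N-1)!)^r.
module Submission where

open import Defs
open import Level using (Level)
open import Data.Nat using (ℕ; _≥_; zero; suc; s≤s; _∸_; _!)
import Data.Nat as ℕ
open import Algebra.Bundles using (CommutativeRing; CommutativeSemiring)
open import Data.Nat.Properties using (≤-trans; m≤n+m)
open import Data.Nat.Combinatorics using (_C_)
open import Data.Fin using (Fin; toℕ; inject₁; fromℕ)
open import Data.Fin.Properties using (toℕ-inject₁; toℕ-fromℕ)
import Relation.Binary.PropositionalEquality as ≡
open ≡ using (_≡_)
import Algebra.Properties.Semiring.Sum as SemiringSum
import Algebra.Properties.Semiring.Mult as SemiringMult
import Algebra.Properties.Semiring.Exp as SemiringExp
import Algebra.Properties.CommutativeSemiring.Exp as CommutativeSemiringExp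
import Algebra.Properties.CommutativeSemiring.Binomial as Binomial
import Algebra.Properties.Group as GroupProperties
import Algebra.Solver.CommutativeMonoid as CommutativeMonoidSolver
import Relation.Binary.Reasoning.Setoid as SetoidReasoning

module _ {c ℓ : Level} (S : CommutativeSemiring c ℓ) where
  open CommutativeSemiring S
  open SemiringExp semiring using (_^_)
  open SemiringMult semiring using (_×_)
  open SemiringSum semiring using (sum⁺-syntax; sum-cong-≋)
  open SetoidReasoning setoid

  1#^n≈1# : ∀ n → 1# ^ n ≈ 1#
  1#^n≈1# zero    = refl
  1#^n≈1# (suc n) = trans (*-identityˡ _) (1#^n≈1# n)

  binomial-+1 : ∀ n a → (a + 1#) ^ n ≈ ∑[ k ≤ n ] ((n C toℕ k) × a ^ toℕ k)
  binomial-+1 n a = begin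
    (a + 1#) ^ n                        ≈⟨ Binomial.theorem S n a 1# ⟩
    Binomial.binomialExpansion S a 1# n ≈⟨ sum-cong-≋ drop-1#-power ⟩
    ∑[ k ≤ n ] ((n C toℕ k) × a ^ toℕ k)  ∎
    where
    drop-1#-power : ∀ k → Binomial.binomialTerm S a 1# n k ≈ (n C toℕ k) × a ^ toℕ k
    drop-1#-power k = SemiringMult.×-congʳ semiring (n C toℕ k)
                        (trans (*-congˡ (1#^n≈1# (n ∸ toℕ k))) (*-identityʳ _))

module _ {c ℓ : Level} (R : CommutativeRing c ℓ)
         (invFact : ℕ → CommutativeRing.Carrier R) (isInvFact : IsInvFact R invFact) where
  open CommutativeRing R
  open SemiringExp semiring using (_^_; ^-congˡ; ^-homo-*)
  open SemiringMult semiring using (_×_; ×-assoc-*)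
  open SemiringSum semiring
    using (sum-syntax; sum⁺-syntax; sum-cong-≋; sum-cong-≗; sum-init-last;
           ∑-distrib-+; ∑-comm; *-distribˡ-sum; *-distribʳ-sum)
  open CommutativeSemiringExp commutativeSemiring using (^-distrib-*)
  open GroupProperties +-group using (//-rightDividesʳ)
  open CommutativeMonoidSolver *-commutativeMonoid using (solve; _⊜_; _⊕_)
  open SetoidReasoning setoid

  ι-*≈× : ∀ m z → ι R m * z ≈ m × z
  ι-*≈× m z = trans (×-assoc-* m 1# z) (SemiringMult.×-congʳ semiring m (*-identityˡ z))

  invFact-suc : ∀ k → ι R (suc k) * invFact (suc k) ≈ invFact k
  invFact-suc k = begin
    ι R (suc k) * invFact (suc k)                                ≈⟨ *-identityˡ _ ⟨
    1# * (ι R (suc k) * invFact (suc k))                         ≈⟨ *-congʳ (isInvFact k) ⟨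
    (ι R (k !) * invFact k) * (ι R (suc k) * invFact (suc k))    ≈⟨ rearrange _ _ _ _ ⟩
    invFact k * ((ι R (suc k) * ι R (k !)) * invFact (suc k))    ≈⟨ *-congˡ (*-congʳ (SemiringMult.×1-homo-* semiring (suc k) (k !))) ⟨
    invFact k * (ι R (suc k !) * invFact (suc k))                ≈⟨ *-congˡ (isInvFact (suc k)) ⟩
    invFact k * 1#                                               ≈⟨ *-identityʳ _ ⟩
    invFact k                                                    ∎
    where
    rearrange : ∀ p q y z → (p * q) * (y * z) ≈ q * ((y * p) * z)
    rearrange = solve 4 (λ p q y z → (p ⊕ q) ⊕ (y ⊕ z) ⊜ q ⊕ ((y ⊕ p) ⊕ z)) refl

  binomialSum : ℕ → (ℕ → Carrier) → Carrier
  binomialSum n f = ∑[ i ≤ n ] (ι R (n C toℕ i) * f (toℕ i))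

  binomialSum-cong : ∀ n {f g : ℕ → Carrier} → (∀ i → f i ≈ g i) → binomialSum n f ≈ binomialSum n g
  binomialSum-cong n f≈g = sum-cong-≋ {suc n} (λ i → *-congˡ {ι R (n C toℕ i)} (f≈g (toℕ i)))

  binomialSum-+ : ∀ n (f g : ℕ → Carrier) →
                  binomialSum n (λ i → f i + g i) ≈ binomialSum n f + binomialSum n g
  binomialSum-+ n f g = begin
    ∑[ i ≤ n ] (a i * (f (toℕ i) + g (toℕ i)))             ≈⟨ sum-cong-≋ {suc n} (λ i → distribˡ (a i) (f (toℕ i)) (g (toℕ i))) ⟩
    ∑[ i ≤ n ] (a i * f (toℕ i) + a i * g (toℕ i))          ≈⟨ ∑-distrib-+ (λ i → a i * f (toℕ i)) (λ i → a i * g (toℕ i)) ⟩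
    binomialSum n f + binomialSum n g                       ∎
    where
    a : Fin (suc n) → Carrier
    a i = ι R (n C toℕ i)

  ∑-binomialSum-comm : ∀ n {N} (f : ℕ → Fin N → Carrier) →
                       ∑[ j < N ] binomialSum n (λ i → f i j) ≈ binomialSum n (λ i → ∑[ j < N ] f i j)
  ∑-binomialSum-comm n f = begin
    ∑[ j < _ ] ∑[ i ≤ n ] (a i * f (toℕ i) j)  ≈⟨ ∑-comm (λ j i → a i * f (toℕ i) j) ⟩
    ∑[ i ≤ n ] ∑[ j < _ ] (a i * f (toℕ i) j)  ≈⟨ sum-cong-≋ {suc n} (λ i → *-distribˡ-sum (a i) (f (toℕ i))) ⟨
    ∑[ i ≤ n ] (a i * ∑[ j < _ ] f (toℕ i) j)  ∎
    where
    a : Fin (suc n) → Carrier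
    a i = ι R (n C toℕ i)

  module _ (r : ℕ) (x : Carrier) where

    summand : ℕ → ℕ → Carrier
    summand m k = ι R k ^ m * x ^ k * invFact k ^ r

    summand-zero : ∀ {m} → m ≥ 1 → summand m 0 ≈ 0#
    summand-zero {suc m} _ = trans (*-congʳ (trans (*-congʳ (zeroˡ _)) (zeroˡ _))) (zeroˡ _)

    summand-suc : ∀ n k → summand (n ℕ.+ r) (suc k) ≈ ι R (suc k) ^ n * x ^ suc k * invFact k ^ r
    summand-suc n k = begin
      a ^ (n ℕ.+ r) * x ^ suc k * invFact (suc k) ^ r    ≈⟨ *-congʳ (*-congʳ (^-homo-* a n r)) ⟩
      (a ^ n * a ^ r) * x ^ suc k * invFact (suc k) ^ r  ≈⟨ rearrange _ _ _ _ ⟩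
      a ^ n * x ^ suc k * (a ^ r * invFact (suc k) ^ r)  ≈⟨ *-congˡ (^-distrib-* a _ r) ⟨
      a ^ n * x ^ suc k * (a * invFact (suc k)) ^ r      ≈⟨ *-congˡ (^-congˡ r (invFact-suc k)) ⟩
      a ^ n * x ^ suc k * invFact k ^ r                  ∎
      where
      a : Carrier
      a = ι R (suc k)
      rearrange : ∀ p q y z → (p * q) * y * z ≈ p * y * (q * z)
      rearrange = solve 4 (λ p q y z → ((p ⊕ q) ⊕ y) ⊕ z ⊜ (p ⊕ y) ⊕ (q ⊕ z)) refl

    x*binomialSum-summand : ∀ n k →
      x * binomialSum n (λ i → summand i k) ≈ ι R (suc k) ^ n * x ^ suc k * invFact k ^ r
    x*binomialSum-summand n k = begin
      x * ∑[ i ≤ n ] (ι R (n C toℕ i) * summand (toℕ i) k)  ≈⟨ *-congˡ (sum-cong-≋ {suc n} (λ i → regroup (n C toℕ i) (toℕ i))) ⟩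
      x * ∑[ i ≤ n ] (b i * w)                              ≈⟨ *-congˡ (*-distribʳ-sum w b) ⟨
      x * (∑[ i ≤ n ] b i * w)                              ≈⟨ *-congˡ (*-congʳ (binomial-+1 commutativeSemiring n (ι R k))) ⟨
      x * ((ι R k + 1#) ^ n * w)                            ≈⟨ *-congˡ (*-congʳ (^-congˡ n (+-comm _ _))) ⟩
      x * (ι R (suc k) ^ n * w)                             ≈⟨ rearrange _ _ _ _ ⟩
      ι R (suc k) ^ n * x ^ suc k * invFact k ^ r           ∎
      where
      w : Carrier
      w = x ^ k * invFact k ^ r
      b : Fin (suc n) → Carrier
      b i = (n C toℕ i) × ι R k ^ toℕ i
      regroup : ∀ m i → ι R m * summand i k ≈ (m × ι R k ^ i) * w
      regroup m i = trans (*-congˡ (*-assoc _ _ _)) (trans (sym (*-assoc _ _ _)) (*-congʳ (ι-*≈× m _)))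
      rearrange : ∀ y c p q → y * (c * (p * q)) ≈ c * (y * p) * q
      rearrange = solve 4 (λ y c p q → y ⊕ (c ⊕ (p ⊕ q)) ⊜ (c ⊕ (y ⊕ p)) ⊕ q) refl

    D-snoc : ∀ M i → D R invFact r (suc M) i x ≈ D R invFact r M i x + summand i M
    D-snoc M i = begin
      D R invFact r (suc M) i x                                         ≈⟨ sum-init-last (λ k → summand i (toℕ k)) ⟩
      ∑[ k < M ] summand i (toℕ (inject₁ k)) + summand i (toℕ (fromℕ M))  ≡⟨ ≡.cong₂ _+_ inits (≡.cong (summand i) (toℕ-fromℕ M)) ⟩
      D R invFact r M i x + summand i M                                 ∎
      where
      inits : ∑[ k < M ] summand i (toℕ (inject₁ k)) ≡ D R invFact r M i x
      inits = sum-cong-≗ {M} (λ k → ≡.cong (summand i) (toℕ-inject₁ k))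

    D-shifted : ∀ n M → r ≥ 1 →
      D R invFact r (suc M) (n ℕ.+ r) x ≈ x * binomialSum n (λ i → D R invFact r M i x)
    D-shifted n M r≥1 = begin
      D R invFact r (suc M) (n ℕ.+ r) x
        ≡⟨⟩
      summand (n ℕ.+ r) 0 + ∑[ k < M ] summand (n ℕ.+ r) (suc (toℕ k))
        ≈⟨ trans (+-congʳ (summand-zero (≤-trans r≥1 (m≤n+m r n)))) (+-identityˡ _) ⟩
      ∑[ k < M ] summand (n ℕ.+ r) (suc (toℕ k))
        ≈⟨ sum-cong-≋ {M} (λ k → trans (summand-suc n (toℕ k)) (sym (x*binomialSum-summand n (toℕ k)))) ⟩
      ∑[ k < M ] (x * binomialSum n (λ i → summand i (toℕ k)))
        ≈⟨ *-distribˡ-sum {M} x (λ k → binomialSum n (λ i → summand i (toℕ k))) ⟨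
      x * ∑[ k < M ] binomialSum n (λ i → summand i (toℕ k))
        ≈⟨ *-congˡ (∑-binomialSum-comm n {M} (λ i k → summand i (toℕ k))) ⟩
      x * binomialSum n (λ i → D R invFact r M i x)
        ∎

    RHS-reduced : ∀ n M → RHS R invFact r (suc M) n x ≈ x * binomialSum n (λ i → D R invFact r M i x)
    RHS-reduced n M = begin
      x * binomialSum n (λ i → D R invFact r (suc M) i x) - E
        ≈⟨ +-congʳ (*-congˡ (binomialSum-cong n (D-snoc M))) ⟩
      x * binomialSum n (λ i → D R invFact r M i x + summand i M) - E
        ≈⟨ +-congʳ (trans (*-congˡ (binomialSum-+ n (λ i → D R invFact r M i x) (λ i → summand i M))) (distribˡ _ _ _)) ⟩
      (x * binomialSum n (λ i → D R invFact r M i x) + x * binomialSum n (λ i → summand i M)) - E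
        ≈⟨ +-congʳ (+-congˡ (x*binomialSum-summand n M)) ⟩
      (x * binomialSum n (λ i → D R invFact r M i x) + E) - E
        ≈⟨ //-rightDividesʳ E _ ⟩
      x * binomialSum n (λ i → D R invFact r M i x)
        ∎
      where
      E : Carrier
      E = ι R (suc M) ^ n * x ^ suc M * invFact M ^ r

open Data.Nat using (_+_)

lemma2p8 : {c ℓ : Level} (R : CommutativeRing c ℓ) (invFact : ℕ → CommutativeRing.Carrier R) →
    IsInvFact R invFact →
    (r n N : ℕ) → r ≥ 1 → N ≥ 1 → (x : CommutativeRing.Carrier R) →
    CommutativeRing._≈_ R (D R invFact r N (n + r) x) (RHS R invFact r N n x)
lemma2p8 R invFact isInvFact r n (suc M) r≥1 (s≤s _) x =
  CommutativeRing.trans R (D-shifted R invFact isInvFact r x n M r≥1)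
                          (CommutativeRing.sym R (RHS-reduced R invFact isInvFact r x n M))
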